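{- Let $k\ge 2$ and $d$ be integers with $0\le d<k/2$, and let $X\ge 1$. Suppose $\mathbf{x}=(x_1,\dots,x_k)$ and $\mathbf{y}=(y_1,\dots,y_k)$ are integer tuples with $1\le x_i,y_i\le X$, satisfying $s_j(\mathbf{x})=s_j(\mathbf{y})$ for all $1\le j\le k$ with $j\ne k-d$, and such that $\mathbf{x}$ is not a permutation of $\mathbf{y}$. Put $h=s_{k-d}(\mathbf{x})-s_{k-d}(\mathbf{y})$. Then: (a) for all $1\le s<t\le k$, \[ \tau_d(\mathbf{y};y_t)\prod_{i=1}^k(y_s-x_i)=\tau_d(\mathbf{y};y_s)\prod_{i=1}^k(y_t-x_i); \] (b) for all $1\le s<t\le k$, \[ \tau_d(\mathbf{x};y_t)\prod_{i=1}^k(y_s-x_i)=\tau_d(\mathbf{x};y_s)\prod_{i=1}^k(y_t-x_i); \] (c) $h\ne 0$, and $\tau_d(\mathbf{y};y_j)=\tau_d(\mathbf{x};y_j)\ne 0$ for $1\le j\le k$.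
   Context: For $\mathbf{z}=(z_1,\dots,z_k)$, $s_j(\mathbf{z})=z_1^j+\dots+z_k^j$. The elementary symmetric polynomials $\sigma_m(\mathbf{z})$ ($0\le m\le k$) are defined by $1+\sum_{m=1}^k\sigma_m(\mathbf{z})(-t)^m=\prod_{i=1}^k(1-tz_i)$, with $\sigma_0(\mathbf{z})=1$. Define \[ \tau_d(\mathbf{z};w)=(-1)^{d-1}\sum_{m=0}^d\sigma_m(\mathbf{z})(-w)^{d-m}. \] -}

module Defs where

open import Data.Nat using (ℕ; zero; suc)
open import Data.Integer using (ℤ; +_; -_; _+_; _-_; _*_; _^_)
open import Data.Fin using (Fin; zero; suc)
open import Data.List using (List; []; _∷_)

∑ : ∀ {k} → (Fin k → ℤ) → ℤ
∑ {zero}  f = + 0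
∑ {suc k} f = f zero + ∑ (λ i → f (suc i))

∏ : ∀ {k} → (Fin k → ℤ) → ℤ
∏ {zero}  f = + 1
∏ {suc k} f = f zero * ∏ (λ i → f (suc i))

powerSum : ∀ {k} → ℕ → (Fin k → ℤ) → ℤ
powerSum j z = ∑ (λ i → z i ^ j)

-- polynomials in t as ascending coefficient lists
Poly : Set
Poly = List ℤ

_+ₚ_ : Poly → Poly → Poly
[] +ₚ q = q
(a ∷ p) +ₚ [] = a ∷ p
(a ∷ p) +ₚ (b ∷ q) = (a + b) ∷ (p +ₚ q)

scaleₚ : ℤ → Poly → Poly
scaleₚ c [] = []
scaleₚ c (a ∷ p) = (c * a) ∷ scaleₚ c p

mulLin : ℤ → Poly → Poly
mulLin z p = p +ₚ (+ 0 ∷ scaleₚ (- z) p)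

genPoly : ∀ {k} → (Fin k → ℤ) → Poly
genPoly {zero}  z = + 1 ∷ []
genPoly {suc k} z = mulLin (z zero) (genPoly (λ i → z (suc i)))

coeff : Poly → ℕ → ℤ
coeff [] m = + 0
coeff (a ∷ p) zero = a
coeff (a ∷ p) (suc m) = coeff p m

sgn : ℕ → ℤ
sgn m = (- (+ 1)) ^ m

-- elementary symmetric polynomial: 1 + Σ σ_m (-t)^m = ∏ (1 - t z_i),
-- i.e. σ_m = (-1)^m · [t^m] ∏ (1 - t z_i)   (σ_0 = 1)
σ : ∀ {k} → ℕ → (Fin k → ℤ) → ℤ
σ m z = sgn m * coeff (genPoly z) m

∑≤ : ℕ → (ℕ → ℤ) → ℤ
∑≤ zero f = f zero
∑≤ (suc n) f = ∑≤ n f + f (suc n)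

-- τ_d(z; w) = (-1)^{d-1} Σ_{m=0}^d σ_m(z) (-w)^{d-m};  (-1)^{d-1} = -(-1)^d
τ : ∀ {k} → ℕ → (Fin k → ℤ) → ℤ → ℤ
τ d z w = - (sgn d) * ∑≤ d (λ m → σ m z * ((- w) ^ (d Data.Nat.∸ m)))

-- Write e_m(z) for the coefficient of t^m in ∏ (1 − t z_i), so that σ_m = (−1)^m e_m, and put
-- n = k − d. Newton's identities (m+1) e_{m+1} + Σ_{j≤m} s_{j+1} e_{m−j} = 0, together with the
-- equality of all power sums except s_n, give by strong induction on m ≤ k that
-- n (e_m(x) − e_m(y)) = −h e_{m−n}(y), with e_i = 0 for i < 0; the induction closes because 2d < k
-- forces e_i(x) = e_i(y) for i ≤ d. Weighting by w^{k−m} and summing turns this into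
-- n ∏ (w − x_i) − n ∏ (w − y_i) = h τ_d(y; w), and at w = y_s the second product vanishes: this
-- gives (a), and (b) since τ_d(x; ·) = τ_d(y; ·). If h = 0 all the e_m agree and x is a permutation
-- of y. Finally τ_d(y; y_j) = −e_d(y without y_j), and (−1)^d e_d of k − 1 ≥ d positive numbers is
-- positive.
module Submission where

open import Defs
open import Data.Fin using (Fin; zero; suc; toℕ; punchIn)
open import Data.Fin.Permutation using (Permutation′; _⟨$⟩ʳ_; insert; insert-punchIn)
import Data.Fin.Permutation as Permutation
open import Data.Integer using (ℤ; +_; -_; _+_; _-_; _*_; _^_; _≤_; +≤+; NonZero)
open import Data.Integer.Properties
  using ( +-identityˡ; +-identityʳ; +-inverseʳ; *-zeroʳ; *-zeroˡ; *-identityˡ; *-identityʳ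
        ; *-distribʳ-+; *-distribˡ-+; *-assoc; neg-distribˡ-*; neg-involutive; *-cancelˡ-≡; i-j≡0⇒i≡j; i*j≡0⇒i≡0∨j≡0
        ; pos-+; pos-*; 0≤i⇒+∣i∣≡i; +-0-abelianGroup)
import Data.Integer.Properties as ℤₚ
open import Algebra.Properties.AbelianGroup +-0-abelianGroup using (inverseˡ-unique; inverseʳ-unique)
open import Data.Integer.Tactic.RingSolver using (solve-∀)
open import Data.Nat as ℕ using (ℕ; zero; suc; _∸_; z≤n; s≤s)
  renaming (_<_ to _<ℕ_; _≤_ to _≤ℕ_; _*_ to _*ℕ_)
open import Data.Nat.Properties as ℕₚ using (≤-refl; ≤-trans; m≤n⇒m≤1+n)
open import Data.Nat.Induction using (<-rec)
open import Data.Product using (_×_; _,_; ∃; proj₁)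
open import Data.Empty using (⊥-elim)
open import Data.Sum using (inj₁; inj₂)
open import Data.Vec.Functional using (head; tail; _∷_; removeAt)
open import Function using (_∘_)
open import Relation.Binary.PropositionalEquality
  using (_≡_; _≢_; refl; sym; trans; cong; cong₂; subst; module ≡-Reasoning)
open import Relation.Nullary using (¬_; yes; no)

open ≡-Reasoning

module _ where
  open import Data.List using ([]) renaming (_∷_ to _∷ₗ_)

  coeff-+ₚ : ∀ p q m → coeff (p +ₚ q) m ≡ coeff p m + coeff q m
  coeff-+ₚ []       q        m       = sym (+-identityˡ (coeff q m))
  coeff-+ₚ (a ∷ₗ p) []       m       = sym (+-identityʳ (coeff (a ∷ₗ p) m))
  coeff-+ₚ (a ∷ₗ p) (b ∷ₗ q) zero    = refl
  coeff-+ₚ (a ∷ₗ p) (b ∷ₗ q) (suc m) = coeff-+ₚ p q m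

  coeff-scaleₚ : ∀ c p m → coeff (scaleₚ c p) m ≡ c * coeff p m
  coeff-scaleₚ c []       m       = sym (*-zeroʳ c)
  coeff-scaleₚ c (a ∷ₗ p) zero    = refl
  coeff-scaleₚ c (a ∷ₗ p) (suc m) = coeff-scaleₚ c p m

-- Coefficients of ∏ (1 − t z_i)

e : ∀ {k} → ℕ → (Fin k → ℤ) → ℤ
e         zero    z = + 1
e {zero}  (suc m) z = + 0
e {suc k} (suc m) z = e (suc m) (tail z) - head z * e m (tail z)

coeff-genPoly : ∀ {k} (z : Fin k → ℤ) m → coeff (genPoly z) m ≡ e m z
coeff-genPoly {zero}  z zero    = refl
coeff-genPoly {zero}  z (suc m) = refl
coeff-genPoly {suc k} z zero    =
  trans (coeff-+ₚ (genPoly (tail z)) _ zero) (trans (+-identityʳ _) (coeff-genPoly (tail z) zero))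
coeff-genPoly {suc k} z (suc m) = begin
  coeff (genPoly z) (suc m)
    ≡⟨ coeff-+ₚ (genPoly (tail z)) _ (suc m) ⟩
  coeff (genPoly (tail z)) (suc m) + coeff (scaleₚ (- head z) (genPoly (tail z))) m
    ≡⟨ cong₂ _+_ (coeff-genPoly (tail z) (suc m)) (coeff-scaleₚ (- head z) (genPoly (tail z)) m) ⟩
  e (suc m) (tail z) + - head z * coeff (genPoly (tail z)) m
    ≡⟨ cong (λ c → e (suc m) (tail z) + - head z * c) (coeff-genPoly (tail z) m) ⟩
  e (suc m) (tail z) + - head z * e m (tail z)
    ≡⟨ cong (λ c → e (suc m) (tail z) + c) (neg-distribˡ-* (head z) (e m (tail z))) ⟨
  e (suc m) z ∎

e-vanish : ∀ {k} (z : Fin k → ℤ) {m} → k <ℕ m → e m z ≡ + 0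
e-vanish {zero}  z {suc m} _         = refl
e-vanish {suc k} z {suc m} (s≤s k<m) = begin
  e (suc m) (tail z) - head z * e m (tail z)
    ≡⟨ cong₂ (λ a b → a - head z * b) (e-vanish (tail z) (m≤n⇒m≤1+n k<m)) (e-vanish (tail z) k<m) ⟩
  + 0 - head z * + 0
    ≡⟨ cong (λ c → + 0 - c) (*-zeroʳ (head z)) ⟩
  + 0 ∎

Series : Set
Series = ℕ → ℤ

infixl 7 _⋆_
_⋆_ : Series → Series → Series
(f ⋆ g) zero    = f zero * g zero
(f ⋆ g) (suc n) = f zero * g (suc n) + (f ∘ suc ⋆ g) n

∂ : Series → Series
∂ g m = + suc m * g (suc m)

mulLinₛ : ℤ → Series → Series
mulLinₛ a g zero    = g zero
mulLinₛ a g (suc m) = g (suc m) - a * g m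

shift : ℕ → Series → Series
shift zero    g m       = g m
shift (suc p) g zero    = + 0
shift (suc p) g (suc m) = shift p g m

monomial : ℕ → Series
monomial zero    zero    = + 1
monomial zero    (suc j) = + 0
monomial (suc p) zero    = + 0
monomial (suc p) (suc j) = monomial p j

monomial-self : ∀ p → monomial p p ≡ + 1
monomial-self zero    = refl
monomial-self (suc p) = monomial-self p

monomial-other : ∀ p j → j ≢ p → monomial p j ≡ + 0
monomial-other zero    zero    j≢p = ⊥-elim (j≢p refl)
monomial-other zero    (suc j) _   = refl
monomial-other (suc p) zero    _   = refl
monomial-other (suc p) (suc j) j≢p = monomial-other p j (j≢p ∘ cong suc)

⋆-cong : ∀ f f′ g g′ n → (∀ i → i ≤ℕ n → f i ≡ f′ i) → (∀ i → i ≤ℕ n → g i ≡ g′ i) →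
         (f ⋆ g) n ≡ (f′ ⋆ g′) n
⋆-cong f f′ g g′ zero    f≈f′ g≈g′ = cong₂ _*_ (f≈f′ 0 z≤n) (g≈g′ 0 z≤n)
⋆-cong f f′ g g′ (suc n) f≈f′ g≈g′ =
  cong₂ _+_ (cong₂ _*_ (f≈f′ 0 z≤n) (g≈g′ (suc n) ≤-refl))
            (⋆-cong (f ∘ suc) (f′ ∘ suc) g g′ n (λ i i≤n → f≈f′ (suc i) (s≤s i≤n))
                                                 (λ i i≤n → g≈g′ i (m≤n⇒m≤1+n i≤n)))

⋆-zeroˡ : ∀ g n → ((λ _ → + 0) ⋆ g) n ≡ + 0
⋆-zeroˡ g zero    = refl
⋆-zeroˡ g (suc n) = cong₂ _+_ (*-zeroˡ (g (suc n))) (⋆-zeroˡ g n)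

⋆-distribʳ-+ : ∀ f f′ g n → ((λ i → f i + f′ i) ⋆ g) n ≡ (f ⋆ g) n + (f′ ⋆ g) n
⋆-distribʳ-+ f f′ g zero    = *-distribʳ-+ (g zero) (f zero) (f′ zero)
⋆-distribʳ-+ f f′ g (suc n) = begin
  (f zero + f′ zero) * g (suc n) + ((λ i → f (suc i) + f′ (suc i)) ⋆ g) n
    ≡⟨ cong (λ c → (f zero + f′ zero) * g (suc n) + c) (⋆-distribʳ-+ (f ∘ suc) (f′ ∘ suc) g n) ⟩
  (f zero + f′ zero) * g (suc n) + ((f ∘ suc ⋆ g) n + (f′ ∘ suc ⋆ g) n)
    ≡⟨ regroup (f zero) (f′ zero) (g (suc n)) _ _ ⟩
  (f zero * g (suc n) + (f ∘ suc ⋆ g) n) + (f′ zero * g (suc n) + (f′ ∘ suc ⋆ g) n) ∎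
  where
  regroup : ∀ (a b c s t : ℤ) → (a + b) * c + (s + t) ≡ (a * c + s) + (b * c + t)
  regroup = solve-∀

⋆-scaleˡ : ∀ a f g n → ((λ i → a * f i) ⋆ g) n ≡ a * (f ⋆ g) n
⋆-scaleˡ a f g zero    = *-assoc a (f zero) (g zero)
⋆-scaleˡ a f g (suc n) = begin
  a * f zero * g (suc n) + ((λ i → a * f (suc i)) ⋆ g) n
    ≡⟨ cong (λ c → a * f zero * g (suc n) + c) (⋆-scaleˡ a (f ∘ suc) g n) ⟩
  a * f zero * g (suc n) + a * (f ∘ suc ⋆ g) n
    ≡⟨ factor a (f zero) (g (suc n)) _ ⟩
  a * (f zero * g (suc n) + (f ∘ suc ⋆ g) n) ∎
  where
  factor : ∀ (a b c s : ℤ) → a * b * c + a * s ≡ a * (b * c + s)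
  factor = solve-∀

⋆-scaleʳ : ∀ a f g n → (f ⋆ (λ i → a * g i)) n ≡ a * (f ⋆ g) n
⋆-scaleʳ a f g zero    = swap a (f zero) (g zero)
  where
  swap : ∀ (a b c : ℤ) → b * (a * c) ≡ a * (b * c)
  swap = solve-∀
⋆-scaleʳ a f g (suc n) = begin
  f zero * (a * g (suc n)) + (f ∘ suc ⋆ (λ i → a * g i)) n
    ≡⟨ cong (λ c → f zero * (a * g (suc n)) + c) (⋆-scaleʳ a (f ∘ suc) g n) ⟩
  f zero * (a * g (suc n)) + a * (f ∘ suc ⋆ g) n
    ≡⟨ factor a (f zero) (g (suc n)) _ ⟩
  a * (f zero * g (suc n) + (f ∘ suc ⋆ g) n) ∎
  where
  factor : ∀ (a b c s : ℤ) → b * (a * c) + a * s ≡ a * (b * c + s)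
  factor = solve-∀

⋆-distribˡ-- : ∀ f g g′ n → (f ⋆ (λ i → g i - g′ i)) n ≡ (f ⋆ g) n - (f ⋆ g′) n
⋆-distribˡ-- f g g′ zero    = distrib (f zero) (g zero) (g′ zero)
  where
  distrib : ∀ (a b c : ℤ) → a * (b - c) ≡ a * b - a * c
  distrib = solve-∀
⋆-distribˡ-- f g g′ (suc n) = begin
  f zero * (g (suc n) - g′ (suc n)) + (f ∘ suc ⋆ (λ i → g i - g′ i)) n
    ≡⟨ cong (λ c → f zero * (g (suc n) - g′ (suc n)) + c) (⋆-distribˡ-- (f ∘ suc) g g′ n) ⟩
  f zero * (g (suc n) - g′ (suc n)) + ((f ∘ suc ⋆ g) n - (f ∘ suc ⋆ g′) n)
    ≡⟨ regroup (f zero) (g (suc n)) (g′ (suc n)) _ _ ⟩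
  (f zero * g (suc n) + (f ∘ suc ⋆ g) n) - (f zero * g′ (suc n) + (f ∘ suc ⋆ g′) n) ∎
  where
  regroup : ∀ (a b c s t : ℤ) → a * (b - c) + (s - t) ≡ (a * b + s) - (a * c + t)
  regroup = solve-∀

⋆-mulLinₛ : ∀ a f g n → (f ⋆ mulLinₛ a g) n ≡ mulLinₛ a (f ⋆ g) n
⋆-mulLinₛ a f g zero          = refl
⋆-mulLinₛ a f g (suc zero)    = expand a (f 0) (f 1) (g 0) (g 1)
  where
  expand : ∀ (a f₀ f₁ g₀ g₁ : ℤ) → f₀ * (g₁ - a * g₀) + f₁ * g₀ ≡ (f₀ * g₁ + f₁ * g₀) - a * (f₀ * g₀)
  expand = solve-∀
⋆-mulLinₛ a f g (suc (suc n)) = begin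
  f zero * (g (2 ℕ.+ n) - a * g (suc n)) + (f ∘ suc ⋆ mulLinₛ a g) (suc n)
    ≡⟨ cong (λ c → f zero * (g (2 ℕ.+ n) - a * g (suc n)) + c) (⋆-mulLinₛ a (f ∘ suc) g (suc n)) ⟩
  f zero * (g (2 ℕ.+ n) - a * g (suc n)) + ((f ∘ suc ⋆ g) (suc n) - a * (f ∘ suc ⋆ g) n)
    ≡⟨ regroup a (f zero) (g (2 ℕ.+ n)) (g (suc n)) _ _ ⟩
  (f zero * g (2 ℕ.+ n) + (f ∘ suc ⋆ g) (suc n)) - a * (f zero * g (suc n) + (f ∘ suc ⋆ g) n) ∎
  where
  regroup : ∀ (a f₀ s t u v : ℤ) → f₀ * (s - a * t) + (u - a * v) ≡ (f₀ * s + u) - a * (f₀ * t + v)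
  regroup = solve-∀

-- (a, a², a³, …) is the series a / (1 − a t).
geometric-⋆-mulLinₛ : ∀ a g n → ((λ j → a ^ suc j) ⋆ mulLinₛ a g) n ≡ a * g n
geometric-⋆-mulLinₛ a g zero    = cong (_* g zero) (*-identityʳ a)
geometric-⋆-mulLinₛ a g (suc n) = begin
  a * + 1 * (g (suc n) - a * g n) + ((λ j → a ^ suc (suc j)) ⋆ mulLinₛ a g) n
    ≡⟨ cong (λ c → a * + 1 * (g (suc n) - a * g n) + c) (⋆-scaleˡ a (λ j → a ^ suc j) (mulLinₛ a g) n) ⟩
  a * + 1 * (g (suc n) - a * g n) + a * ((λ j → a ^ suc j) ⋆ mulLinₛ a g) n
    ≡⟨ cong (λ c → a * + 1 * (g (suc n) - a * g n) + a * c) (geometric-⋆-mulLinₛ a g n) ⟩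
  a * + 1 * (g (suc n) - a * g n) + a * (a * g n)
    ≡⟨ telescope a (g (suc n)) (g n) ⟩
  a * g (suc n) ∎
  where
  telescope : ∀ (a s t : ℤ) → a * + 1 * (s - a * t) + a * (a * t) ≡ a * s
  telescope = solve-∀

monomial-⋆ : ∀ p g n → (monomial p ⋆ g) n ≡ shift p g n
monomial-⋆ zero    g zero    = *-identityˡ (g zero)
monomial-⋆ zero    g (suc n) = begin
  + 1 * g (suc n) + ((λ _ → + 0) ⋆ g) n ≡⟨ cong₂ _+_ (*-identityˡ (g (suc n))) (⋆-zeroˡ g n) ⟩
  g (suc n) + + 0                      ≡⟨ +-identityʳ (g (suc n)) ⟩
  g (suc n)                            ∎
monomial-⋆ (suc p) g zero    = *-zeroˡ (g zero)
monomial-⋆ (suc p) g (suc n) =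
  trans (cong₂ _+_ (*-zeroˡ (g (suc n))) (monomial-⋆ p g n)) (+-identityˡ (shift p g n))

⋆-shift : ∀ p f g n → (f ⋆ shift p g) n ≡ shift p (f ⋆ g) n
⋆-shift zero    f g n       = ⋆-cong f f (shift zero g) g n (λ _ _ → refl) (λ _ _ → refl)
⋆-shift (suc p) f g zero    = *-zeroʳ (f zero)
⋆-shift (suc p) f g (suc n) = trans (⋆-shift-suc f n) (⋆-shift p f g n)
  where
  ⋆-shift-suc : ∀ f n → (f ⋆ shift (suc p) g) (suc n) ≡ (f ⋆ shift p g) n
  ⋆-shift-suc f zero    =
    trans (cong (λ c → f zero * shift p g zero + c) (*-zeroʳ (f 1))) (+-identityʳ _)
  ⋆-shift-suc f (suc n) = cong (λ c → f zero * shift p g (suc n) + c) (⋆-shift-suc (f ∘ suc) n)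

shift-cong : ∀ p g g′ n → (∀ i → i ℕ.+ p ≤ℕ n → g i ≡ g′ i) → shift p g n ≡ shift p g′ n
shift-cong zero    g g′ n       g≈g′ = g≈g′ n (ℕₚ.≤-reflexive (ℕₚ.+-identityʳ n))
shift-cong (suc p) g g′ zero    g≈g′ = refl
shift-cong (suc p) g g′ (suc n) g≈g′ =
  shift-cong p g g′ n (λ i i+p≤n → g≈g′ i (subst (_≤ℕ suc n) (sym (ℕₚ.+-suc i p)) (s≤s i+p≤n)))

shift-below : ∀ p g {n} → n <ℕ p → shift p g n ≡ + 0
shift-below (suc p) g {zero}  _         = refl
shift-below (suc p) g {suc n} (s≤s n<p) = shift-below p g n<p

shift-neg : ∀ p g n → shift p (λ i → - g i) n ≡ - shift p g n
shift-neg zero    g n       = refl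
shift-neg (suc p) g zero    = refl
shift-neg (suc p) g (suc n) = shift-neg p g n

shift-∂ : ∀ p g n → shift (suc p) (∂ g) n ≡ (+ n - + p) * shift p g n
shift-∂ zero    g zero    = refl
shift-∂ zero    g (suc n) = cong (_* g (suc n)) (sym (+-identityʳ (+ suc n)))
shift-∂ (suc p) g zero    = sym (*-zeroʳ (+ 0 - + suc p))
shift-∂ (suc p) g (suc n) = trans (shift-∂ p g n) (cong (_* shift p g n) (sub-suc (+ n) (+ p)))
  where
  sub-suc : ∀ (a b : ℤ) → a - b ≡ + 1 + a - (+ 1 + b)
  sub-suc = solve-∀

∂-mulLinₛ : ∀ a g m → ∂ (mulLinₛ a g) m ≡ mulLinₛ a (∂ g) m - a * g m
∂-mulLinₛ a g zero    = expand a (g 1) (g 0)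
  where
  expand : ∀ (a s t : ℤ) → + 1 * (s - a * t) ≡ + 1 * s - a * t
  expand = solve-∀
∂-mulLinₛ a g (suc m) = expand a (+ m) (g (2 ℕ.+ m)) (g (suc m))
  where
  expand : ∀ (a m s t : ℤ) →
           (+ 1 + (+ 1 + m)) * (s - a * t) ≡ (+ 1 + (+ 1 + m)) * s - a * ((+ 1 + m) * t) - a * t
  expand = solve-∀

mulLinₛ-sum-zero : ∀ a f g → (∀ m → f m + g m ≡ + 0) → ∀ m → mulLinₛ a f m + mulLinₛ a g m ≡ + 0
mulLinₛ-sum-zero a f g f+g≡0 zero    = f+g≡0 zero
mulLinₛ-sum-zero a f g f+g≡0 (suc m) = begin
  (f (suc m) - a * f m) + (g (suc m) - a * g m) ≡⟨ regroup a (f (suc m)) (g (suc m)) (f m) (g m) ⟩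
  (f (suc m) + g (suc m)) - a * (f m + g m)     ≡⟨ cong₂ (λ s t → s - a * t) (f+g≡0 (suc m)) (f+g≡0 m) ⟩
  + 0 - a * + 0                                 ≡⟨ cong (λ c → + 0 - c) (*-zeroʳ a) ⟩
  + 0                                           ∎
  where
  regroup : ∀ (a s t u v : ℤ) → (s - a * u) + (t - a * v) ≡ (s + t) - a * (u + v)
  regroup = solve-∀

-- Newton's identities

powerSums : ∀ {k} → (Fin k → ℤ) → Series
powerSums z j = powerSum (suc j) z

E : ∀ {k} → (Fin k → ℤ) → Series
E z m = e m z

E-∷ : ∀ {k} (z : Fin (suc k) → ℤ) m → E z m ≡ mulLinₛ (head z) (E (tail z)) m
E-∷ z zero    = refl
E-∷ z (suc m) = refl

-- Peel off one entry: E_{a ∷ u} = (1 − a t) E_u and P_{a ∷ u} = a / (1 − a t) + P_u.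
newton : ∀ {k} (z : Fin k → ℤ) m → ∂ (E z) m + (powerSums z ⋆ E z) m ≡ + 0
newton {zero}  z m = cong₂ _+_ (*-zeroʳ (+ suc m)) (⋆-zeroˡ (E z) m)
newton {suc k} z m = begin
  ∂ (E z) m + (powerSums z ⋆ E z) m
    ≡⟨ cong₂ _+_ (∂-mulLinₛ a Eₜ m)
                 (⋆-cong (powerSums z) (powerSums z) (E z) (mulLinₛ a Eₜ) m (λ _ _ → refl) (λ i _ → E-∷ z i)) ⟩
  mulLinₛ a (∂ Eₜ) m - a * Eₜ m + (powerSums z ⋆ mulLinₛ a Eₜ) m
    ≡⟨ cong (λ c → mulLinₛ a (∂ Eₜ) m - a * Eₜ m + c)
            (⋆-distribʳ-+ (λ j → a ^ suc j) (powerSums (tail z)) (mulLinₛ a Eₜ) m) ⟩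
  mulLinₛ a (∂ Eₜ) m - a * Eₜ m + (((λ j → a ^ suc j) ⋆ mulLinₛ a Eₜ) m + (powerSums (tail z) ⋆ mulLinₛ a Eₜ) m)
    ≡⟨ cong₂ (λ s t → mulLinₛ a (∂ Eₜ) m - a * Eₜ m + (s + t))
             (geometric-⋆-mulLinₛ a Eₜ m) (⋆-mulLinₛ a (powerSums (tail z)) Eₜ m) ⟩
  mulLinₛ a (∂ Eₜ) m - a * Eₜ m + (a * Eₜ m + mulLinₛ a (powerSums (tail z) ⋆ Eₜ) m)
    ≡⟨ cancel (mulLinₛ a (∂ Eₜ) m) (a * Eₜ m) _ ⟩
  mulLinₛ a (∂ Eₜ) m + mulLinₛ a (powerSums (tail z) ⋆ Eₜ) m
    ≡⟨ mulLinₛ-sum-zero a (∂ Eₜ) (powerSums (tail z) ⋆ Eₜ) (newton (tail z)) m ⟩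
  + 0 ∎
  where
  a  = head z
  Eₜ = E (tail z)
  cancel : ∀ (s t u : ℤ) → s - t + (t + u) ≡ s + u
  cancel = solve-∀

∂E≡-⋆ : ∀ {k} (z : Fin k → ℤ) m → ∂ (E z) m ≡ - (powerSums z ⋆ E z) m
∂E≡-⋆ z m = inverseˡ-unique _ _ (newton z m)

⋆≡-∂E : ∀ {k} (z : Fin k → ℤ) m → (powerSums z ⋆ E z) m ≡ - ∂ (E z) m
⋆≡-∂E z m = inverseʳ-unique _ _ (newton z m)

horner : Series → ℤ → ℕ → ℤ
horner c w zero    = c zero
horner c w (suc d) = w * horner c w d + c (suc d)

horner-cong : ∀ c c′ w d → (∀ m → m ≤ℕ d → c m ≡ c′ m) → horner c w d ≡ horner c′ w d
horner-cong c c′ w zero    c≈c′ = c≈c′ zero z≤n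
horner-cong c c′ w (suc d) c≈c′ =
  cong₂ (λ s t → w * s + t) (horner-cong c c′ w d (λ m m≤d → c≈c′ m (m≤n⇒m≤1+n m≤d))) (c≈c′ (suc d) ≤-refl)

horner-scale : ∀ a c w d → horner (λ m → a * c m) w d ≡ a * horner c w d
horner-scale a c w zero    = refl
horner-scale a c w (suc d) = begin
  w * horner (λ m → a * c m) w d + a * c (suc d) ≡⟨ cong (λ s → w * s + a * c (suc d)) (horner-scale a c w d) ⟩
  w * (a * horner c w d) + a * c (suc d)         ≡⟨ factor w a (horner c w d) (c (suc d)) ⟩
  a * (w * horner c w d + c (suc d))             ∎
  where
  factor : ∀ (w a s t : ℤ) → w * (a * s) + a * t ≡ a * (w * s + t)
  factor = solve-∀

horner-- : ∀ c c′ w d → horner (λ m → c m - c′ m) w d ≡ horner c w d - horner c′ w d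
horner-- c c′ w zero    = refl
horner-- c c′ w (suc d) = begin
  w * horner (λ m → c m - c′ m) w d + (c (suc d) - c′ (suc d))
    ≡⟨ cong (λ s → w * s + (c (suc d) - c′ (suc d))) (horner-- c c′ w d) ⟩
  w * (horner c w d - horner c′ w d) + (c (suc d) - c′ (suc d))
    ≡⟨ regroup w (horner c w d) (horner c′ w d) (c (suc d)) (c′ (suc d)) ⟩
  (w * horner c w d + c (suc d)) - (w * horner c′ w d + c′ (suc d)) ∎
  where
  regroup : ∀ (w s t u v : ℤ) → w * (s - t) + (u - v) ≡ (w * s + u) - (w * t + v)
  regroup = solve-∀

horner-shift : ∀ p c w d → horner (shift p c) w (p ℕ.+ d) ≡ horner c w d
horner-shift zero    c w d = refl
horner-shift (suc p) c w d = trans (horner-shift-suc (p ℕ.+ d)) (horner-shift p c w d)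
  where
  horner-shift-suc : ∀ d → horner (shift (suc p) c) w (suc d) ≡ horner (shift p c) w d
  horner-shift-suc zero    = trans (cong (λ s → s + shift p c zero) (*-zeroʳ w)) (+-identityˡ _)
  horner-shift-suc (suc d) = cong (λ s → w * s + shift p c (suc d)) (horner-shift-suc d)

horner-E-∷ : ∀ {k} (z : Fin (suc k) → ℤ) w d →
             horner (E z) w (suc d) ≡ horner (E (tail z)) w (suc d) - head z * horner (E (tail z)) w d
horner-E-∷ z w zero    = regroup w (e 1 (tail z)) (head z)
  where
  regroup : ∀ (w s a : ℤ) → w * + 1 + (s - a * + 1) ≡ (w * + 1 + s) - a * + 1
  regroup = solve-∀
horner-E-∷ z w (suc d) = begin
  w * horner (E z) w (suc d) + e (2 ℕ.+ d) z
    ≡⟨ cong (λ s → w * s + e (2 ℕ.+ d) z) (horner-E-∷ z w d) ⟩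
  w * (horner (E (tail z)) w (suc d) - head z * horner (E (tail z)) w d) + e (2 ℕ.+ d) z
    ≡⟨ regroup w (horner (E (tail z)) w (suc d)) (horner (E (tail z)) w d)
               (e (2 ℕ.+ d) (tail z)) (e (suc d) (tail z)) (head z) ⟩
  horner (E (tail z)) w (2 ℕ.+ d) - head z * horner (E (tail z)) w (suc d) ∎
  where
  regroup : ∀ (w s t u v a : ℤ) → w * (s - a * t) + (u - a * v) ≡ (w * s + u) - a * (w * t + v)
  regroup = solve-∀

∏-horner : ∀ {k} (z : Fin k → ℤ) w → ∏ (λ i → w - z i) ≡ horner (E z) w k
∏-horner {zero}  z w = refl
∏-horner {suc k} z w = begin
  (w - head z) * ∏ (λ i → w - tail z i)
    ≡⟨ cong ((w - head z) *_) (∏-horner (tail z) w) ⟩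
  (w - head z) * horner (E (tail z)) w k
    ≡⟨ expand w (head z) (horner (E (tail z)) w k) ⟩
  (w * horner (E (tail z)) w k + + 0) - head z * horner (E (tail z)) w k
    ≡⟨ cong (λ s → (w * horner (E (tail z)) w k + s) - head z * horner (E (tail z)) w k)
            (e-vanish (tail z) ≤-refl) ⟨
  horner (E (tail z)) w (suc k) - head z * horner (E (tail z)) w k
    ≡⟨ horner-E-∷ z w k ⟨
  horner (E z) w (suc k) ∎
  where
  expand : ∀ (w a s : ℤ) → (w - a) * s ≡ (w * s + + 0) - a * s
  expand = solve-∀

horner-E-head : ∀ {k} (z : Fin (suc k) → ℤ) d → horner (E z) (head z) d ≡ e d (tail z)
horner-E-head z zero    = refl
horner-E-head z (suc d) = begin
  head z * horner (E z) (head z) d + (e (suc d) (tail z) - head z * e d (tail z))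
    ≡⟨ cong (λ s → head z * s + (e (suc d) (tail z) - head z * e d (tail z))) (horner-E-head z d) ⟩
  head z * e d (tail z) + (e (suc d) (tail z) - head z * e d (tail z))
    ≡⟨ cancel (head z * e d (tail z)) (e (suc d) (tail z)) ⟩
  e (suc d) (tail z) ∎
  where
  cancel : ∀ (s t : ℤ) → s + (t - s) ≡ t
  cancel = solve-∀

horner-E-removeAt : ∀ {k} (z : Fin (suc k) → ℤ) j d → horner (E z) (z j) d ≡ e d (removeAt z j)
horner-E-removeAt         z zero    d       = horner-E-head z d
horner-E-removeAt {suc k} z (suc j) zero    = refl
horner-E-removeAt {suc k} z (suc j) (suc d) =
  trans (horner-E-∷ z (z (suc j)) d)
        (cong₂ (λ s t → s - head z * t) (horner-E-removeAt (tail z) j (suc d)) (horner-E-removeAt (tail z) j d))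

∑≤-cong : ∀ d f g → (∀ m → m ≤ℕ d → f m ≡ g m) → ∑≤ d f ≡ ∑≤ d g
∑≤-cong zero    f g f≈g = f≈g zero z≤n
∑≤-cong (suc d) f g f≈g =
  cong₂ _+_ (∑≤-cong d f g (λ m m≤d → f≈g m (m≤n⇒m≤1+n m≤d))) (f≈g (suc d) ≤-refl)

∑≤-distribˡ : ∀ a d f → ∑≤ d (λ m → a * f m) ≡ a * ∑≤ d f
∑≤-distribˡ a zero    f = refl
∑≤-distribˡ a (suc d) f =
  trans (cong (λ s → s + a * f (suc d)) (∑≤-distribˡ a d f)) (sym (*-distribˡ-+ a (∑≤ d f) (f (suc d))))

sgn-square : ∀ d → sgn d * sgn d ≡ + 1
sgn-square zero    = refl
sgn-square (suc d) = trans (square-neg (sgn d)) (sgn-square d)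
  where
  square-neg : ∀ (s : ℤ) → (- + 1 * s) * (- + 1 * s) ≡ s * s
  square-neg = solve-∀

∑≤-signed : ∀ c w d → ∑≤ d (λ m → (sgn m * c m) * (- w) ^ (d ∸ m)) ≡ sgn d * horner c w d
∑≤-signed c w zero    = *-identityʳ (+ 1 * c zero)
∑≤-signed c w (suc d) = begin
  ∑≤ d (λ m → (sgn m * c m) * (- w) ^ (suc d ∸ m)) + (sgn (suc d) * c (suc d)) * (- w) ^ (d ∸ d)
    ≡⟨ cong₂ _+_ (∑≤-cong d _ _ (λ m m≤d → lower-power m m≤d))
                 (cong (λ p → (sgn (suc d) * c (suc d)) * (- w) ^ p) (ℕₚ.n∸n≡0 d)) ⟩
  ∑≤ d (λ m → - w * ((sgn m * c m) * (- w) ^ (d ∸ m))) + (sgn (suc d) * c (suc d)) * + 1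
    ≡⟨ cong (λ s → s + (sgn (suc d) * c (suc d)) * + 1)
            (trans (∑≤-distribˡ (- w) d _) (cong (- w *_) (∑≤-signed c w d))) ⟩
  - w * (sgn d * horner c w d) + (sgn (suc d) * c (suc d)) * + 1
    ≡⟨ regroup w (sgn d) (horner c w d) (c (suc d)) ⟩
  sgn (suc d) * horner c w (suc d) ∎
  where
  lower-power : ∀ m → m ≤ℕ d →
                (sgn m * c m) * (- w) ^ (suc d ∸ m) ≡ - w * ((sgn m * c m) * (- w) ^ (d ∸ m))
  lower-power m m≤d = trans (cong (λ p → (sgn m * c m) * (- w) ^ p) (ℕₚ.+-∸-assoc 1 m≤d))
                            (swap (sgn m * c m) (- w) ((- w) ^ (d ∸ m)))
    where
    swap : ∀ (a b s : ℤ) → a * (b * s) ≡ b * (a * s)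
    swap = solve-∀
  regroup : ∀ (w s h c : ℤ) → - w * (s * h) + ((- + 1 * s) * c) * + 1 ≡ (- + 1 * s) * (w * h + c)
  regroup = solve-∀

τ≡-horner : ∀ {k} d (z : Fin k → ℤ) w → τ d z w ≡ - horner (E z) w d
τ≡-horner d z w = begin
  - sgn d * ∑≤ d (λ m → (sgn m * c m) * (- w) ^ (d ∸ m)) ≡⟨ cong (- sgn d *_) (∑≤-signed c w d) ⟩
  - sgn d * (sgn d * horner c w d)                     ≡⟨ regroup (sgn d) (horner c w d) ⟩
  - (sgn d * sgn d * horner c w d)                     ≡⟨ cong (λ s → - (s * horner c w d)) (sgn-square d) ⟩
  - (+ 1 * horner c w d)                               ≡⟨ cong -_ (*-identityˡ (horner c w d)) ⟩
  - horner c w d                                       ≡⟨ cong -_ (horner-cong c (E z) w d (λ m _ → coeff-genPoly z m)) ⟩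
  - horner (E z) w d                                   ∎
  where
  c = coeff (genPoly z)
  regroup : ∀ (s h : ℤ) → - s * (s * h) ≡ - (s * s * h)
  regroup = solve-∀

sgn*e-suc : ∀ {k} (z : Fin (suc k) → ℤ) m {p a q} →
            sgn (suc m) * e (suc m) (tail z) ≡ + p → head z ≡ + a → sgn m * e m (tail z) ≡ + q →
            sgn (suc m) * e (suc m) z ≡ + (p ℕ.+ a *ℕ q)
sgn*e-suc z m {p} {a} {q} ≡p ≡a ≡q = begin
  sgn (suc m) * e (suc m) z
    ≡⟨ expand (sgn m) (e (suc m) (tail z)) (head z) (e m (tail z)) ⟩
  sgn (suc m) * e (suc m) (tail z) + head z * (sgn m * e m (tail z))
    ≡⟨ cong₂ (λ s t → s + t) ≡p (cong₂ _*_ ≡a ≡q) ⟩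
  + p + + a * + q
    ≡⟨ cong (λ s → + p + s) (pos-* a q) ⟨
  + p + + (a *ℕ q)
    ≡⟨ pos-+ p (a *ℕ q) ⟨
  + (p ℕ.+ a *ℕ q) ∎
  where
  expand : ∀ (s u a v : ℤ) → (- + 1 * s) * (u - a * v) ≡ (- + 1 * s) * u + a * (s * v)
  expand = solve-∀

sgn*e-nonneg : ∀ {k} (z : Fin k → ℤ) → (∀ i → + 0 ≤ z i) → ∀ m → ∃ λ p → sgn m * e m z ≡ + p
sgn*e-nonneg         z z≥0 zero    = 1 , refl
sgn*e-nonneg {zero}  z z≥0 (suc m) = 0 , *-zeroʳ (sgn (suc m))
sgn*e-nonneg {suc k} z z≥0 (suc m) =
  let p , ≡p = sgn*e-nonneg (tail z) (z≥0 ∘ suc) (suc m)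
      q , ≡q = sgn*e-nonneg (tail z) (z≥0 ∘ suc) m
  in  _ , sgn*e-suc z m ≡p (sym (0≤i⇒+∣i∣≡i (z≥0 zero))) ≡q

sgn*e-positive : ∀ {k} (z : Fin k → ℤ) → (∀ i → + 1 ≤ z i) → ∀ {m} → m ≤ℕ k →
                 ∃ λ p → sgn m * e m z ≡ + suc p
sgn*e-positive         z z≥1 {zero}  _         = 0 , refl
sgn*e-positive {suc k} z z≥1 {suc m} (s≤s m≤k) =
  let p , ≡p = sgn*e-nonneg (tail z) (λ i → ℤₚ.≤-trans (+≤+ z≤n) (z≥1 (suc i))) (suc m)
      q , ≡q = sgn*e-positive (tail z) (z≥1 ∘ suc) m≤k
      a , ≡a = positive-witness (z≥1 zero)
  in  p ℕ.+ (q ℕ.+ a *ℕ suc q) ,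
      trans (sgn*e-suc z m ≡p ≡a ≡q) (cong +_ (ℕₚ.+-suc p (q ℕ.+ a *ℕ suc q)))
  where
  positive-witness : ∀ {i} → + 1 ≤ i → ∃ λ a → i ≡ + suc a
  positive-witness {+ suc a} (+≤+ (s≤s _)) = a , refl

e-nonzero : ∀ {k} (z : Fin k → ℤ) → (∀ i → + 1 ≤ z i) → ∀ {m} → m ≤ℕ k → e m z ≢ + 0
e-nonzero z z≥1 {m} m≤k e≡0 with sgn*e-positive z z≥1 m≤k
... | p , ≡p with () ← trans (sym ≡p) (trans (cong (sgn m *_) e≡0) (*-zeroʳ (sgn m)))

τ-at-entry≢0 : ∀ {k} d (z : Fin k → ℤ) j → (∀ i → + 1 ≤ z i) → d <ℕ k → τ d z (z j) ≢ + 0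
τ-at-entry≢0 {suc k} d z j z≥1 (s≤s d≤k) τ≡0 = e-nonzero (removeAt z j) (z≥1 ∘ punchIn j) d≤k (begin
  e d (removeAt z j)     ≡⟨ horner-E-removeAt z j d ⟨
  horner (E z) (z j) d   ≡⟨ neg-involutive _ ⟨
  - - horner (E z) (z j) d ≡⟨ cong -_ (τ≡-horner d z (z j)) ⟨
  - τ d z (z j)          ≡⟨ cong -_ τ≡0 ⟩
  + 0                    ∎)

-- Recovering a permutation from the e_m

e-η : ∀ {k} (z : Fin (suc k) → ℤ) m → e m z ≡ e m (head z ∷ tail z)
e-η z zero    = refl
e-η z (suc m) = refl

e-∷-cong : ∀ {k} a {u v : Fin k → ℤ} → (∀ m → e m u ≡ e m v) → ∀ m → e m (a ∷ u) ≡ e m (a ∷ v)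
e-∷-cong a u≈v zero    = refl
e-∷-cong a u≈v (suc m) = cong₂ (λ s t → s - a * t) (u≈v (suc m)) (u≈v m)

e-∷-cancel : ∀ {k} a {u v : Fin k → ℤ} → (∀ m → e m (a ∷ u) ≡ e m (a ∷ v)) → ∀ m → e m u ≡ e m v
e-∷-cancel a         au≈av zero    = refl
e-∷-cancel a {u} {v} au≈av (suc m) = begin
  e (suc m) u                         ≡⟨ sub-add (e (suc m) u) (a * e m u) ⟨
  e (suc m) u - a * e m u + a * e m u ≡⟨ cong₂ _+_ (au≈av (suc m)) (cong (a *_) (e-∷-cancel a au≈av m)) ⟩
  e (suc m) v - a * e m v + a * e m v ≡⟨ sub-add (e (suc m) v) (a * e m v) ⟩
  e (suc m) v                         ∎
  where
  sub-add : ∀ (s t : ℤ) → s - t + t ≡ s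
  sub-add = solve-∀

e-swap : ∀ {k} a b (u : Fin k → ℤ) m → e m (a ∷ b ∷ u) ≡ e m (b ∷ a ∷ u)
e-swap a b u zero          = refl
e-swap a b u (suc zero)    = swap₁ a b (e 1 u)
  where
  swap₁ : ∀ (a b s : ℤ) → s - b * + 1 - a * + 1 ≡ s - a * + 1 - b * + 1
  swap₁ = solve-∀
e-swap a b u (suc (suc m)) = swap a b (e (suc (suc m)) u) (e (suc m) u) (e m u)
  where
  swap : ∀ (a b s t r : ℤ) → s - b * t - a * (t - b * r) ≡ s - a * t - b * (t - a * r)
  swap = solve-∀

e-removeAt : ∀ {k} (z : Fin (suc k) → ℤ) j m → e m z ≡ e m (z j ∷ removeAt z j)
e-removeAt         z zero    m = e-η z m
e-removeAt {suc k} z (suc j) m = begin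
  e m z                                          ≡⟨ e-η z m ⟩
  e m (head z ∷ tail z)                          ≡⟨ e-∷-cong (head z) (e-removeAt (tail z) j) m ⟩
  e m (head z ∷ z (suc j) ∷ removeAt (tail z) j) ≡⟨ e-swap (head z) (z (suc j)) _ m ⟩
  e m (z (suc j) ∷ head z ∷ removeAt (tail z) j) ≡⟨ e-∷-cong (z (suc j)) (λ i → sym (e-η (removeAt z (suc j)) i)) m ⟩
  e m (z (suc j) ∷ removeAt z (suc j))           ∎

∏-zero : ∀ {k} (f : Fin k → ℤ) j → f j ≡ + 0 → ∏ f ≡ + 0
∏-zero f zero    f₀≡0 = trans (cong (_* ∏ (f ∘ suc)) f₀≡0) (*-zeroˡ (∏ (f ∘ suc)))
∏-zero f (suc j) fⱼ≡0 = trans (cong (f zero *_) (∏-zero (f ∘ suc) j fⱼ≡0)) (*-zeroʳ (f zero))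

∏≡0⇒factor≡0 : ∀ {k} (f : Fin k → ℤ) → ∏ f ≡ + 0 → ∃ λ i → f i ≡ + 0
∏≡0⇒factor≡0 {zero}  f ()
∏≡0⇒factor≡0 {suc k} f ∏≡0 with i*j≡0⇒i≡0∨j≡0 (f zero) ∏≡0
... | inj₁ f₀≡0 = zero , f₀≡0
... | inj₂ ∏≡0′ = let i , fᵢ≡0 = ∏≡0⇒factor≡0 (f ∘ suc) ∏≡0′ in suc i , fᵢ≡0

-- y₁ is a root of ∏ (t − y_i), hence of the equal polynomial ∏ (t − x_i).
head-root : ∀ {k} (x y : Fin (suc k) → ℤ) → (∀ m → e m x ≡ e m y) → ∃ λ i → x i ≡ head y
head-root {k} x y same = let i , y₁-xᵢ≡0 = ∏≡0⇒factor≡0 (λ i → head y - x i) ∏≡0 in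
  i , sym (i-j≡0⇒i≡j (head y) (x i) y₁-xᵢ≡0)
  where
  ∏≡0 : ∏ (λ i → head y - x i) ≡ + 0
  ∏≡0 = begin
    ∏ (λ i → head y - x i)       ≡⟨ ∏-horner x (head y) ⟩
    horner (E x) (head y) (suc k) ≡⟨ horner-cong (E x) (E y) (head y) (suc k) (λ m _ → same m) ⟩
    horner (E y) (head y) (suc k) ≡⟨ ∏-horner y (head y) ⟨
    ∏ (λ i → head y - y i)       ≡⟨ ∏-zero (λ i → head y - y i) zero (+-inverseʳ (head y)) ⟩
    + 0                          ∎

removeAt-root : ∀ {k} (x y : Fin (suc k) → ℤ) i → x i ≡ head y → (∀ m → e m x ≡ e m y) →
                ∀ m → e m (removeAt x i) ≡ e m (tail y)
removeAt-root x y i xᵢ≡y₁ same = e-∷-cancel (head y) λ m → begin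
  e m (head y ∷ removeAt x i) ≡⟨ cong (λ a → e m (a ∷ removeAt x i)) xᵢ≡y₁ ⟨
  e m (x i ∷ removeAt x i)    ≡⟨ e-removeAt x i m ⟨
  e m x                       ≡⟨ same m ⟩
  e m y                       ≡⟨ e-η y m ⟩
  e m (head y ∷ tail y)       ∎

same-e⇒permutation : ∀ {k} (x y : Fin k → ℤ) → (∀ m → e m x ≡ e m y) →
                     ∃ λ (π : Permutation′ k) → ∀ i → x (π ⟨$⟩ʳ i) ≡ y i
same-e⇒permutation {zero}  x y same = Permutation.id , λ ()
same-e⇒permutation {suc k} x y same =
  let i , xᵢ≡y₁ = head-root x y same
      π , xπ≡y′ = same-e⇒permutation (removeAt x i) (tail y) (removeAt-root x y i xᵢ≡y₁ same)
  in  insert zero i π , λ where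
        zero    → xᵢ≡y₁
        (suc j) → trans (cong x (insert-punchIn zero i π j)) (xπ≡y′ j)

cross-multiply : ∀ (c a b A B h : ℤ) .{{_ : NonZero c}} → c * A ≡ h * a → c * B ≡ h * b → b * A ≡ a * B
cross-multiply c a b A B h cA≡ha cB≡hb = *-cancelˡ-≡ c (b * A) (a * B) (begin
  c * (b * A) ≡⟨ swap c b A ⟩
  b * (c * A) ≡⟨ cong (b *_) cA≡ha ⟩
  b * (h * a) ≡⟨ swap b h a ⟩
  h * (b * a) ≡⟨ cong (h *_) (ℤₚ.*-comm b a) ⟩
  h * (a * b) ≡⟨ swap a h b ⟨
  a * (h * b) ≡⟨ cong (a *_) cB≡hb ⟨
  a * (c * B) ≡⟨ swap c a B ⟨
  c * (a * B) ∎)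
  where
  swap : ∀ (a b c : ℤ) → a * (b * c) ≡ b * (a * c)
  swap = solve-∀

-- The gap identity

module PowerSumGap
  {k : ℕ} (n d : ℕ) (k≡1+n+d : k ≡ suc n ℕ.+ d) (d≤n : d ≤ℕ n) (x y : Fin k → ℤ)
  (agree : ∀ j → suc j ≤ℕ k → j ≢ n → powerSums x j ≡ powerSums y j) where

  h : ℤ
  h = powerSums x n - powerSums y n

  Gap : ℕ → Set
  Gap m = + suc n * (e m x - e m y) ≡ - h * shift (suc n) (E y) m

  scaled-difference≡0 : ∀ {m} → + suc n * (e m x - e m y) ≡ + 0 → e m x ≡ e m y
  scaled-difference≡0 ≡0 = i-j≡0⇒i≡j _ _ (*-cancelˡ-≡ (+ suc n) _ (+ 0) (trans ≡0 (sym (*-zeroʳ (+ suc n)))))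

  gap-below : ∀ {m} → m ≤ℕ n → Gap m → e m x ≡ e m y
  gap-below {m} m≤n gap = scaled-difference≡0 {m} (trans gap
    (trans (cong (- h *_) (shift-below (suc n) (E y) (s≤s m≤n))) (*-zeroʳ (- h))))

  gap-zero : Gap 0
  gap-zero = trans (*-zeroʳ (+ suc n)) (sym (*-zeroʳ (- h)))

  gap-suc : ∀ m → suc m ≤ℕ k → (∀ i → i ≤ℕ m → Gap i) → Gap (suc m)
  gap-suc m m<k ih = *-cancelˡ-≡ (+ suc m) _ _ (begin
      + suc m * (+ suc n * (e (suc m) x - e (suc m) y))
    ≡⟨ distribute (+ suc m) (+ suc n) (e (suc m) x) (e (suc m) y) ⟩
      + suc n * (∂ (E x) m - ∂ (E y) m)
    ≡⟨ cong₂ (λ s t → + suc n * (s - t)) (∂E≡-⋆ x m) (∂E≡-⋆ y m) ⟩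
      + suc n * (- (powerSums x ⋆ E x) m - - (powerSums y ⋆ E y) m)
    ≡⟨ cong (λ s → + suc n * (- s - - (powerSums y ⋆ E y) m)) powerSums-x⋆Ex ⟩
      + suc n * (- (h * S + (powerSums y ⋆ E x) m) - - (powerSums y ⋆ E y) m)
    ≡⟨ regroup (+ suc n) (h * S) ((powerSums y ⋆ E x) m) ((powerSums y ⋆ E y) m) ⟩
      - (+ suc n * (h * S)) - + suc n * ((powerSums y ⋆ E x) m - (powerSums y ⋆ E y) m)
    ≡⟨ cong (λ s → - (+ suc n * (h * S)) - s) powerSums-y⋆difference ⟩
      - (+ suc n * (h * S)) - h * ((+ m - + n) * S)
    ≡⟨ collect (+ m) (+ n) h S ⟩
      + suc m * (- h * S) ∎)
    where
    distribute : ∀ (c N a b : ℤ) → c * (N * (a - b)) ≡ N * (c * a - c * b)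
    distribute = solve-∀
    regroup : ∀ (N u v w : ℤ) → N * (- (u + v) - - w) ≡ - (N * u) - N * (v - w)
    regroup = solve-∀
    collect : ∀ (m n h S : ℤ) → - ((+ 1 + n) * (h * S)) - h * ((m - n) * S) ≡ (+ 1 + m) * (- h * S)
    collect = solve-∀
    sub-add : ∀ (s t : ℤ) → s ≡ (s - t) + t
    sub-add = solve-∀
    neg-neg : ∀ (a b : ℤ) → - a * - b ≡ a * b
    neg-neg = solve-∀

    S = shift n (E y) m

    m≤n+d : m ≤ℕ n ℕ.+ d
    m≤n+d = ℕₚ.≤-pred (subst (suc m ≤ℕ_) k≡1+n+d m<k)

    low-agree : ∀ i → i ℕ.+ n ≤ℕ m → e i x ≡ e i y
    low-agree i i+n≤m = gap-below (≤-trans i≤d d≤n) (ih i (≤-trans (ℕₚ.m≤m+n i n) i+n≤m))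
      where
      i≤d : i ≤ℕ d
      i≤d = ℕₚ.+-cancelʳ-≤ n i d (≤-trans i+n≤m (subst (m ≤ℕ_) (ℕₚ.+-comm n d) m≤n+d))

    powerSum-difference : ∀ j → j ≤ℕ m → powerSums x j - powerSums y j ≡ h * monomial n j
    powerSum-difference j j≤m with j ℕ.≟ n
    ... | yes refl = sym (trans (cong (h *_) (monomial-self n)) (*-identityʳ h))
    ... | no  j≢n  = begin
      powerSums x j - powerSums y j ≡⟨ cong (λ s → s - powerSums y j) (agree j (≤-trans (s≤s j≤m) m<k) j≢n) ⟩
      powerSums y j - powerSums y j ≡⟨ +-inverseʳ (powerSums y j) ⟩
      + 0                           ≡⟨ *-zeroʳ h ⟨
      h * + 0                       ≡⟨ cong (h *_) (monomial-other n j j≢n) ⟨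
      h * monomial n j              ∎

    powerSums-x⋆Ex : (powerSums x ⋆ E x) m ≡ h * S + (powerSums y ⋆ E x) m
    powerSums-x⋆Ex = begin
      (powerSums x ⋆ E x) m
        ≡⟨ ⋆-cong _ (λ j → (powerSums x j - powerSums y j) + powerSums y j) (E x) (E x) m
                  (λ j _ → sub-add (powerSums x j) (powerSums y j)) (λ _ _ → refl) ⟩
      ((λ j → (powerSums x j - powerSums y j) + powerSums y j) ⋆ E x) m
        ≡⟨ ⋆-distribʳ-+ (λ j → powerSums x j - powerSums y j) (powerSums y) (E x) m ⟩
      ((λ j → powerSums x j - powerSums y j) ⋆ E x) m + (powerSums y ⋆ E x) m
        ≡⟨ cong (λ s → s + (powerSums y ⋆ E x) m) (begin
             ((λ j → powerSums x j - powerSums y j) ⋆ E x) m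
               ≡⟨ ⋆-cong _ (λ j → h * monomial n j) (E x) (E x) m powerSum-difference (λ _ _ → refl) ⟩
             ((λ j → h * monomial n j) ⋆ E x) m
               ≡⟨ ⋆-scaleˡ h (monomial n) (E x) m ⟩
             h * (monomial n ⋆ E x) m
               ≡⟨ cong (h *_) (monomial-⋆ n (E x) m) ⟩
             h * shift n (E x) m
               ≡⟨ cong (h *_) (shift-cong n (E x) (E y) m low-agree) ⟩
             h * S ∎) ⟩
      h * S + (powerSums y ⋆ E x) m ∎

    powerSums-y⋆difference : + suc n * ((powerSums y ⋆ E x) m - (powerSums y ⋆ E y) m) ≡ h * ((+ m - + n) * S)
    powerSums-y⋆difference = begin
      + suc n * ((powerSums y ⋆ E x) m - (powerSums y ⋆ E y) m)
        ≡⟨ cong (+ suc n *_) (⋆-distribˡ-- (powerSums y) (E x) (E y) m) ⟨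
      + suc n * (powerSums y ⋆ (λ i → e i x - e i y)) m
        ≡⟨ ⋆-scaleʳ (+ suc n) (powerSums y) (λ i → e i x - e i y) m ⟨
      (powerSums y ⋆ (λ i → + suc n * (e i x - e i y))) m
        ≡⟨ ⋆-cong (powerSums y) (powerSums y) _ (λ i → - h * shift (suc n) (E y) i) m (λ _ _ → refl) ih ⟩
      (powerSums y ⋆ (λ i → - h * shift (suc n) (E y) i)) m
        ≡⟨ ⋆-scaleʳ (- h) (powerSums y) (shift (suc n) (E y)) m ⟩
      - h * (powerSums y ⋆ shift (suc n) (E y)) m
        ≡⟨ cong (- h *_) (⋆-shift (suc n) (powerSums y) (E y) m) ⟩
      - h * shift (suc n) (powerSums y ⋆ E y) m
        ≡⟨ cong (- h *_) (shift-cong (suc n) _ (λ j → - ∂ (E y) j) m (λ j _ → ⋆≡-∂E y j)) ⟩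
      - h * shift (suc n) (λ j → - ∂ (E y) j) m
        ≡⟨ cong (- h *_) (shift-neg (suc n) (∂ (E y)) m) ⟩
      - h * - shift (suc n) (∂ (E y)) m
        ≡⟨ cong (λ s → - h * - s) (shift-∂ n (E y) m) ⟩
      - h * - ((+ m - + n) * S)
        ≡⟨ neg-neg h ((+ m - + n) * S) ⟩
      h * ((+ m - + n) * S) ∎


  gap : ∀ m → m ≤ℕ k → Gap m
  gap = <-rec (λ m → m ≤ℕ k → Gap m) step
    where
    step : ∀ m → (∀ {i} → i <ℕ m → i ≤ℕ k → Gap i) → m ≤ℕ k → Gap m
    step zero    _  _   = gap-zero
    step (suc m) ih m<k = gap-suc m m<k (λ i i≤m → ih (s≤s i≤m) (≤-trans i≤m (ℕₚ.<⇒≤ m<k)))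

  low-e-agree : ∀ m → m ≤ℕ n → e m x ≡ e m y
  low-e-agree m m≤n = gap-below m≤n (gap m (≤-trans m≤n n≤k))
    where
    n≤k : n ≤ℕ k
    n≤k = subst (n ≤ℕ_) (sym k≡1+n+d) (m≤n⇒m≤1+n (ℕₚ.m≤m+n n d))

  h≡0⇒same-e : h ≡ + 0 → ∀ m → e m x ≡ e m y
  h≡0⇒same-e h≡0 m with ℕₚ.≤-<-connex m k
  ... | inj₁ m≤k = scaled-difference≡0 {m} (trans (gap m m≤k)
                     (trans (cong (λ c → - c * shift (suc n) (E y) m) h≡0) (*-zeroˡ (shift (suc n) (E y) m))))
  ... | inj₂ k<m = trans (e-vanish x k<m) (sym (e-vanish y k<m))

  ∏-gap : ∀ w → + suc n * ∏ (λ i → w - x i) - + suc n * ∏ (λ i → w - y i) ≡ - h * horner (E y) w d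
  ∏-gap w = begin
    + suc n * ∏ (λ i → w - x i) - + suc n * ∏ (λ i → w - y i)
      ≡⟨ cong₂ (λ s t → + suc n * s - + suc n * t) (∏-horner x w) (∏-horner y w) ⟩
    + suc n * horner (E x) w k - + suc n * horner (E y) w k
      ≡⟨ factor (+ suc n) (horner (E x) w k) (horner (E y) w k) ⟩
    + suc n * (horner (E x) w k - horner (E y) w k)
      ≡⟨ cong (+ suc n *_) (horner-- (E x) (E y) w k) ⟨
    + suc n * horner (λ m → e m x - e m y) w k
      ≡⟨ horner-scale (+ suc n) (λ m → e m x - e m y) w k ⟨
    horner (λ m → + suc n * (e m x - e m y)) w k
      ≡⟨ horner-cong _ _ w k gap ⟩
    horner (λ m → - h * shift (suc n) (E y) m) w k
      ≡⟨ horner-scale (- h) (shift (suc n) (E y)) w k ⟩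
    - h * horner (shift (suc n) (E y)) w k
      ≡⟨ cong (λ K → - h * horner (shift (suc n) (E y)) w K) k≡1+n+d ⟩
    - h * horner (shift (suc n) (E y)) w (suc n ℕ.+ d)
      ≡⟨ cong (- h *_) (horner-shift (suc n) (E y) w d) ⟩
    - h * horner (E y) w d ∎
    where
    factor : ∀ (c s t : ℤ) → c * s - c * t ≡ c * (s - t)
    factor = solve-∀

  τ-agree : ∀ w → τ d y w ≡ τ d x w
  τ-agree w = begin
    τ d y w           ≡⟨ τ≡-horner d y w ⟩
    - horner (E y) w d ≡⟨ cong -_ (horner-cong (E y) (E x) w d λ m m≤d → sym (low-e-agree m (≤-trans m≤d d≤n))) ⟩
    - horner (E x) w d ≡⟨ τ≡-horner d x w ⟨
    τ d x w           ∎

  root-gap : ∀ s → + suc n * ∏ (λ i → y s - x i) ≡ h * τ d y (y s)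
  root-gap s = begin
    + suc n * ∏ (λ i → y s - x i)
      ≡⟨ drop-zero (+ suc n) (∏ (λ i → y s - x i)) ⟨
    + suc n * ∏ (λ i → y s - x i) - + suc n * + 0
      ≡⟨ cong (λ t → + suc n * ∏ (λ i → y s - x i) - + suc n * t)
              (∏-zero (λ i → y s - y i) s (+-inverseʳ (y s))) ⟨
    + suc n * ∏ (λ i → y s - x i) - + suc n * ∏ (λ i → y s - y i)
      ≡⟨ ∏-gap (y s) ⟩
    - h * horner (E y) (y s) d
      ≡⟨ trans (sym (neg-distribˡ-* h _)) (ℤₚ.neg-distribʳ-* h _) ⟩
    h * - horner (E y) (y s) d
      ≡⟨ cong (h *_) (τ≡-horner d y (y s)) ⟨
    h * τ d y (y s) ∎
    where
    drop-zero : ∀ (c t : ℤ) → c * t - c * + 0 ≡ c * t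
    drop-zero = solve-∀

2d<k⇒k≡1+n+d : ∀ {k d} → 2 *ℕ d <ℕ k → ∃ λ n → k ≡ suc n ℕ.+ d × d ≤ℕ n
2d<k⇒k≡1+n+d {k} {d} 2d<k = k ∸ suc d , k≡1+n+d , d≤n
  where
  k≡1+n+d : k ≡ suc (k ∸ suc d) ℕ.+ d
  k≡1+n+d = trans (sym (ℕₚ.m+[n∸m]≡n (ℕₚ.≤-<-trans (ℕₚ.m≤m+n d _) 2d<k))) (cong suc (ℕₚ.+-comm d _))
  d≤n : d ≤ℕ k ∸ suc d
  d≤n = ℕₚ.+-cancelʳ-≤ d d _ (ℕₚ.≤-pred (subst (suc (d ℕ.+ d) ≤ℕ_) k≡1+n+d
          (subst (λ t → suc (d ℕ.+ t) ≤ℕ k) (ℕₚ.+-identityʳ d) 2d<k)))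

lemma2p1 : (k d : ℕ) (X : ℤ) (x y : Fin k → ℤ) →
    2 ≤ℕ k → 2 *ℕ d <ℕ k → + 1 ≤ X →
    (∀ i → + 1 ≤ x i × x i ≤ X) → (∀ i → + 1 ≤ y i × y i ≤ X) →
    (∀ j → 1 ≤ℕ j → j ≤ℕ k → j ≢ k ∸ d → powerSum j x ≡ powerSum j y) →
    ¬ (∃ λ (π : Permutation′ k) → ∀ i → x (π ⟨$⟩ʳ i) ≡ y i) →
    let h = powerSum (k ∸ d) x - powerSum (k ∸ d) y in
    (∀ (s t : Fin k) → toℕ s <ℕ toℕ t →
      τ d y (y t) * ∏ (λ i → y s - x i) ≡ τ d y (y s) * ∏ (λ i → y t - x i))
    × (∀ (s t : Fin k) → toℕ s <ℕ toℕ t →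
      τ d x (y t) * ∏ (λ i → y s - x i) ≡ τ d x (y s) * ∏ (λ i → y t - x i))
    × (h ≢ + 0)
    × (∀ (j : Fin k) → τ d y (y j) ≡ τ d x (y j) × τ d x (y j) ≢ + 0)
lemma2p1 k d X x y _ 2d<k _ _ y-bounds agree not-permutation with 2d<k⇒k≡1+n+d 2d<k
... | n , k≡1+n+d , d≤n =
    (λ s t _ → cross-multiply (+ suc n) _ _ _ _ h (root-gap s) (root-gap t))
  , (λ s t _ → cross-multiply (+ suc n) _ _ _ _ h (root-gapₓ s) (root-gapₓ t))
  , (λ h′≡0 → not-permutation (same-e⇒permutation x y (h≡0⇒same-e (trans h≡h′ h′≡0))))
  , λ j → τ-agree (y j) , λ τ≡0 → τ-at-entry≢0 d y j (proj₁ ∘ y-bounds) d<k (trans (τ-agree (y j)) τ≡0)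
  where
  k∸d≡1+n : k ∸ d ≡ suc n
  k∸d≡1+n = trans (cong (_∸ d) k≡1+n+d) (ℕₚ.m+n∸n≡m (suc n) d)

  d<k : d <ℕ k
  d<k = subst (d <ℕ_) (sym k≡1+n+d) (s≤s (ℕₚ.m≤n+m d n))

  agree′ : ∀ j → suc j ≤ℕ k → j ≢ n → powerSums x j ≡ powerSums y j
  agree′ j j<k j≢n =
    agree (suc j) (s≤s z≤n) j<k (λ 1+j≡k∸d → j≢n (ℕₚ.suc-injective (trans 1+j≡k∸d k∸d≡1+n)))

  open PowerSumGap n d k≡1+n+d d≤n x y agree′

  h≡h′ : h ≡ powerSum (k ∸ d) x - powerSum (k ∸ d) y
  h≡h′ = cong (λ j → powerSum j x - powerSum j y) (sym k∸d≡1+n)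

  root-gapₓ : ∀ s → + suc n * ∏ (λ i → y s - x i) ≡ h * τ d x (y s)
  root-gapₓ s = trans (root-gap s) (cong (h *_) (τ-agree (y s)))
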